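{- For $n\geq 2$, let $\mathrm{Dic}_n=\langle a,x \mid a^{2n}=e,\ x^2=a^n,\ x^{ -1}ax=a^{ -1}\rangle$ be the dicyclic group of order $4n$. Then Player 1 has a winning strategy for $\texttt{RAV}(\mathrm{Dic}_n,\{a,x\})$.
   Context: Every element of $\mathrm{Dic}_n$ has a unique normal form $a^ix^j$ with $0\le i<2n$ and $j\in\{0,1\}$. Game $\texttt{RAV}(G,S)$: $G$ is a finite group and $S$ a generating set with $e\notin S$. Two players alternate turns, Player 1 first, starting from the empty word $w_0$. On turn $n$ the current player chooses $s_n\in S\cup S^{ -1}$, subject to $s_n\neq s_{n-1}^{ -1}$ when $n>1$, and forms $w_n=w_{n-1}s_n$. If $w_n$ represents the same element of $G$ as some $w_k$ with $0\le k<n$, the player who formed $w_n$ loses. If a player has no legal move, that player loses. -}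

module Defs where

open import Data.Nat using (ℕ; zero; suc; _+_; _*_; _∸_; NonZero)
open import Data.Nat.DivMod using (_mod_)
open import Data.Fin using (Fin; toℕ)
open import Data.Bool using (Bool; true; false)
open import Data.Product using (_×_; _,_)
open import Data.List using (List; []; _∷_; _++_; map)
open import Data.List.Membership.Propositional using (_∈_; _∉_)
open import Data.Maybe using (Maybe; just; nothing)
open import Relation.Binary.PropositionalEquality using (_≡_; _≢_)
open import Relation.Nullary using (¬_)
open import Data.Unit using (⊤)

-- Group elements are compared with propositional equality, so the
-- carrier must be a set of canonical representatives (normal forms).

record GameData : Set₁ where
  field
    Carrier : Set
    e       : Carrier
    _∙_     : Carrier → Carrier → Carrier
    _⁻¹     : Carrier → Carrier
    S       : List Carrier

module RAV (G : GameData) where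
  open GameData G

  Moves : List Carrier
  Moves = S ++ map _⁻¹ S

  Allowed : Maybe Carrier → Carrier → Set
  Allowed nothing  s = ⊤
  Allowed (just t) s = s ≢ t ⁻¹

  -- A position: the list `vis` of the group elements represented by
  -- w_0, …, w_{n-1} (which contains the current element `cur` = value of
  -- w_{n-1}), the current element, and the previous move (if any).
  --
  -- Win  vis cur last : the player about to move has a winning strategy.
  -- Lose vis cur last : the player about to move has no winning strategy,
  --                     i.e. the opponent has a winning strategy.
  -- A move s that makes cur ∙ s equal to an already visited element loses
  -- immediately for the mover; if there is no legal move the mover loses.
  data Win  (vis : List Carrier) (cur : Carrier) (last : Maybe Carrier) : Set
  data Lose (vis : List Carrier) (cur : Carrier) (last : Maybe Carrier) : Set

  data Win vis cur last where
    win : (s : Carrier) → s ∈ Moves → Allowed last s →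
          (cur ∙ s) ∉ vis →
          Lose ((cur ∙ s) ∷ vis) (cur ∙ s) (just s) →
          Win vis cur last

  data Lose vis cur last where
    lose : ((s : Carrier) → s ∈ Moves → Allowed last s →
            (cur ∙ s) ∉ vis →
            Win ((cur ∙ s) ∷ vis) (cur ∙ s) (just s)) →
           Lose vis cur last

  Player1Wins : Set
  Player1Wins = Win (e ∷ []) e nothing

-- The dicyclic group Dic_n of order 4n, via the normal form a^i x^j,
-- 0 ≤ i < 2n, j ∈ {0,1}   (element (i , false) = a^i, (i , true) = a^i x).
-- Relations used: x a = a⁻¹ x, x² = aⁿ.

nz2 : ∀ n → .{{NonZero n}} → NonZero (2 * n)
nz2 (suc n) = _

module Dicyclic (n : ℕ) .{{nzn : NonZero n}} where

  instance
    nz2n : NonZero (2 * n)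
    nz2n = nz2 n

  Dic : Set
  Dic = Fin (2 * n) × Bool

  [_] : ℕ → Fin (2 * n)
  [ m ] = m mod (2 * n)

  neg : Fin (2 * n) → ℕ
  neg k = 2 * n ∸ toℕ k

  e : Dic
  e = ([ 0 ] , false)

  _∙_ : Dic → Dic → Dic
  (i , false) ∙ (k , l)     = ([ toℕ i + toℕ k ] , l)
  (i , true)  ∙ (k , false) = ([ toℕ i + neg k ] , true)
  (i , true)  ∙ (k , true)  = ([ toℕ i + neg k + n ] , false)

  _⁻¹ : Dic → Dic
  (i , false) ⁻¹ = ([ neg i ] , false)
  (i , true)  ⁻¹ = ([ toℕ i + n ] , true)

  a x : Dic
  a = ([ 1 ] , false)
  x = ([ 0 ] , true)

DicGame : (n : ℕ) → .{{NonZero n}} → GameData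
DicGame n = record
  { Carrier = Dic ; e = e ; _∙_ = _∙_ ; _⁻¹ = _⁻¹ ; S = a ∷ x ∷ [] }
  where open Dicyclic n

-- Pair every element g of Dic_n with g x if g ∈ ⟨a⟩ and with
-- g x⁻¹ otherwise; this is a fixed-point-free involution, each pair being
-- joined by a single move. Player 1 opens with e → x, completing the pair
-- of e. From then on, whenever Player 2 reaches a fresh element, Player 1
-- moves to its partner, which is fresh too because the visited set is
-- always a union of pairs. This reply never undoes Player 2's move: a move
-- by a^{±1} is answered by x^{±1}, and a move by x^{±1} must leave the pair
-- it started from (moving inside that pair revisits an element), so it is
-- answered by the same letter x^{±1}, which differs from its inverse
-- because x has order 4. As the group is finite, Player 2 eventually runs
-- out of moves.
module Submission where

open import Defs
open import Data.Nat using (ℕ; suc; _+_; _*_; _∸_; _%_; _≤_; _<_; s≤s; NonZero; >-nonZero⁻¹; ≢-nonZero⁻¹)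
open import Data.Nat.Properties using (m≤n⇒m≤1+n; <-≤-trans; ≤-<-trans; ≤-pred; ≤-refl; <⇒≤; +-assoc; +-identityʳ; m<m+n; m∸n+n≡m)
open import Data.Nat.DivMod using (m%n<n; m<n⇒m%n≡m; [m+n]%n≡m%n; n%n≡0)
open import Data.Fin using (toℕ)
open import Data.Fin.Properties using (toℕ-injective; toℕ-fromℕ<; toℕ<n) renaming (_≟_ to _≟ᶠ_)
open import Data.Bool using (true; false)
open import Data.Bool.Properties using () renaming (_≟_ to _≟ᵇ_)
open import Data.Product using (_,_; proj₁)
open import Data.Product.Properties using (≡-dec)
open import Data.List using (List; []; _∷_; filter; length; allFin; cartesianProduct)
open import Data.List.Relation.Unary.Any using (Any; here; there)
open import Data.List.Membership.Propositional as ∈ using (_∈_; _∉_)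
open import Data.List.Membership.Propositional.Properties using (∈-allFin; ∈-cartesianProduct⁺)
open import Data.List.Relation.Binary.Sublist.Propositional using (⊆-refl)
open import Data.List.Relation.Binary.Sublist.Propositional.Properties using (filter⁺; length-mono-≤)
open import Data.Maybe using (just)
open import Data.Unit using (tt)
open import Relation.Unary using (Pred; Decidable; _⊆_; _∩_; ∁)
open import Relation.Nullary using (yes; no; ¬?; contradiction)
open import Relation.Binary.Definitions using (DecidableEquality)
open import Relation.Binary.PropositionalEquality using (_≡_; _≢_; refl; sym; trans; cong; subst; module ≡-Reasoning)

module _ {a p q} {A : Set a} {P : Pred A p} {Q : Pred A q}
         (P? : Decidable P) (Q? : Decidable Q) (P⊆Q : P ⊆ Q) where

  length-filter-mono-≤ : ∀ xs → length (filter P? xs) ≤ length (filter Q? xs)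
  length-filter-mono-≤ xs = length-mono-≤ (filter⁺ P? Q? (λ { refl → P⊆Q }) (⊆-refl {x = xs}))

  length-filter-mono-< : ∀ {xs} → Any (Q ∩ ∁ P) xs →
                         length (filter P? xs) < length (filter Q? xs)
  length-filter-mono-< {x ∷ xs} (here (qx , ¬px)) with P? x | Q? x
  ... | yes px | _      = contradiction px ¬px
  ... | no _   | yes _  = s≤s (length-filter-mono-≤ xs)
  ... | no _   | no ¬qx = contradiction qx ¬qx
  length-filter-mono-< {x ∷ xs} (there any) with P? x | Q? x
  ... | yes px | no ¬qx = contradiction (P⊆Q px) ¬qx
  ... | yes _  | yes _  = s≤s (length-filter-mono-< any)
  ... | no _   | yes _  = m≤n⇒m≤1+n (length-filter-mono-< any)
  ... | no _   | no _   = length-filter-mono-< any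

module PairingStrategy (G : GameData) (reply : GameData.Carrier G → GameData.Carrier G) where
  open GameData G
  open RAV G

  partner : Carrier → Carrier
  partner g = g ∙ reply g

  Paired : List Carrier → Set
  Paired vis = ∀ {g} → g ∈ vis → partner g ∈ vis

  module _ (_≟_ : DecidableEquality Carrier)
           (elements : List Carrier) (∈-elements : ∀ g → g ∈ elements)
           (reply∈Moves : ∀ g → reply g ∈ Moves)
           (partner-involutive : ∀ g → partner (partner g) ≡ g)
           (partner≢id : ∀ g → partner g ≢ g)
           (reply-allowed : ∀ g t → t ∈ Moves → g ∙ t ≢ partner g → reply (g ∙ t) ≢ t ⁻¹)
           where

    open import Data.List.Membership.DecPropositional _≟_ using (_∈?_)

    paired-∷ : ∀ {vis} g → Paired vis → Paired (partner g ∷ g ∷ vis)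
    paired-∷ {vis} g paired (here refl) =
      subst (_∈ partner g ∷ g ∷ vis) (sym (partner-involutive g)) (there (here refl))
    paired-∷ g paired (there (here refl)) = here refl
    paired-∷ g paired (there (there g∈vis)) = there (there (paired g∈vis))

    partner∉ : ∀ {vis g} → Paired vis → g ∉ vis → partner g ∉ g ∷ vis
    partner∉ paired g∉vis (here eq) = partner≢id _ eq
    partner∉ {vis} {g} paired g∉vis (there p∈vis) =
      g∉vis (subst (_∈ vis) (partner-involutive g) (paired p∈vis))

    unvisited : List Carrier → ℕ
    unvisited vis = length (filter (λ g → ¬? (g ∈? vis)) elements)

    unvisited-∷-≤ : ∀ g vis → unvisited (g ∷ vis) ≤ unvisited vis
    unvisited-∷-≤ g vis = length-filter-mono-≤ (λ h → ¬? (h ∈? (g ∷ vis))) (λ h → ¬? (h ∈? vis))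
                            (λ h∉ h∈ → h∉ (there h∈)) elements

    unvisited-∷-< : ∀ {g vis} → g ∉ vis → unvisited (g ∷ vis) < unvisited vis
    unvisited-∷-< {g} {vis} g∉vis =
      length-filter-mono-< (λ h → ¬? (h ∈? (g ∷ vis))) (λ h → ¬? (h ∈? vis))
        (λ h∉ h∈ → h∉ (there h∈))
        (∈.lose (∈-elements g) (g∉vis , λ g∉ → g∉ (here refl)))

    -- The bound k is fuel: two fresh elements are visited per round.
    mover-loses : ∀ k {vis cur last} → unvisited vis < k → Paired vis → cur ∈ vis →
                  Lose vis cur last
    mover-loses (suc k) {vis} {cur} bound paired cur∈vis = lose answer
      where
        answer : ∀ t → t ∈ Moves → Allowed _ t → cur ∙ t ∉ vis →
                 Win (cur ∙ t ∷ vis) (cur ∙ t) (just t)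
        answer t t∈Moves _ g∉vis =
          win (reply g) (reply∈Moves g) (reply-allowed cur t t∈Moves g≢partner)
              (partner∉ paired g∉vis) (mover-loses k bound′ (paired-∷ g paired) (here refl))
          where
            g : Carrier
            g = cur ∙ t

            g≢partner : g ≢ partner cur
            g≢partner g≡p = g∉vis (subst (_∈ vis) (sym g≡p) (paired cur∈vis))

            bound′ : unvisited (partner g ∷ g ∷ vis) < k
            bound′ = <-≤-trans (≤-<-trans (unvisited-∷-≤ _ _) (unvisited-∷-< g∉vis)) (≤-pred bound)

    first-player-wins : Player1Wins
    first-player-wins =
      win (reply e) (reply∈Moves e) tt (partner∉ (λ ()) (λ ()))
          (mover-loses _ ≤-refl (paired-∷ e (λ ())) (here refl))

module DicyclicPairing (n : ℕ) .{{_ : NonZero n}} where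
  open Dicyclic n
  open RAV (DicGame n) using (Moves; Player1Wins)

  toℕ-[] : ∀ m → toℕ [ m ] ≡ m % (2 * n)
  toℕ-[] m = toℕ-fromℕ< (m%n<n m (2 * n))

  []-cong-% : ∀ {m m′} → m % (2 * n) ≡ m′ % (2 * n) → [ m ] ≡ [ m′ ]
  []-cong-% {m} {m′} eq = toℕ-injective (trans (toℕ-[] m) (trans eq (sym (toℕ-[] m′))))

  toℕ-[<] : ∀ {m} → m < 2 * n → toℕ [ m ] ≡ m
  toℕ-[<] {m} m<2n = trans (toℕ-[] m) (m<n⇒m%n≡m m<2n)

  [toℕ] : ∀ i → [ toℕ i ] ≡ i
  [toℕ] i = toℕ-injective (toℕ-[<] (toℕ<n i))

  n<2n : n < 2 * n
  n<2n = m<m+n n (subst (0 <_) (sym (+-identityʳ n)) (>-nonZero⁻¹ n))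

  toℕ-[0] : toℕ [ 0 ] ≡ 0
  toℕ-[0] = toℕ-[<] (>-nonZero⁻¹ (2 * n))

  toℕ-[n] : toℕ [ n ] ≡ n
  toℕ-[n] = toℕ-[<] n<2n

  x⁻¹≡[n]x : x ⁻¹ ≡ ([ n ] , true)
  x⁻¹≡[n]x = cong (λ k → [ k + n ] , true) toℕ-[0]

  x⁻¹⁻¹≡x : (x ⁻¹) ⁻¹ ≡ x
  x⁻¹⁻¹≡x = trans (cong _⁻¹ x⁻¹≡[n]x) (cong (_, true) ([]-cong-% (begin
      (toℕ [ n ] + n) % (2 * n)  ≡⟨ cong (λ k → (k + n) % (2 * n)) toℕ-[n] ⟩
      (n + n) % (2 * n)          ≡⟨ cong (λ k → (n + k) % (2 * n)) (sym (+-identityʳ n)) ⟩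
      (2 * n) % (2 * n)          ≡⟨ n%n≡0 (2 * n) ⟩
      0                          ≡⟨ sym (m<n⇒m%n≡m (>-nonZero⁻¹ (2 * n))) ⟩
      0 % (2 * n)                ∎)))
    where open ≡-Reasoning

  x≢x⁻¹ : x ≢ x ⁻¹
  x≢x⁻¹ x≡x⁻¹ = ≢-nonZero⁻¹ n (begin
      n                   ≡⟨ sym toℕ-[n] ⟩
      toℕ [ n ]           ≡⟨ cong (λ g → toℕ (proj₁ g)) (sym (trans x≡x⁻¹ x⁻¹≡[n]x)) ⟩
      toℕ [ 0 ]           ≡⟨ toℕ-[0] ⟩
      0                   ∎)
    where open ≡-Reasoning

  a^i∙x : ∀ i → (i , false) ∙ x ≡ (i , true)
  a^i∙x i = cong (_, true) (begin
      [ toℕ i + toℕ [ 0 ] ]  ≡⟨ cong (λ k → [ toℕ i + k ]) toℕ-[0] ⟩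
      [ toℕ i + 0 ]          ≡⟨ cong [_] (+-identityʳ (toℕ i)) ⟩
      [ toℕ i ]              ≡⟨ [toℕ] i ⟩
      i                      ∎)
    where open ≡-Reasoning

  a^ix∙x⁻¹ : ∀ i → (i , true) ∙ (x ⁻¹) ≡ (i , false)
  a^ix∙x⁻¹ i = trans (cong ((i , true) ∙_) x⁻¹≡[n]x) (cong (_, false) (toℕ-injective (begin
      toℕ [ toℕ i + neg [ n ] + n ]                ≡⟨ toℕ-[] _ ⟩
      (toℕ i + (2 * n ∸ toℕ [ n ]) + n) % (2 * n)  ≡⟨ cong (λ k → (toℕ i + (2 * n ∸ k) + n) % (2 * n)) toℕ-[n] ⟩
      (toℕ i + (2 * n ∸ n) + n) % (2 * n)          ≡⟨ cong (_% (2 * n)) (+-assoc (toℕ i) _ n) ⟩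
      (toℕ i + (2 * n ∸ n + n)) % (2 * n)          ≡⟨ cong (λ k → (toℕ i + k) % (2 * n)) (m∸n+n≡m (<⇒≤ n<2n)) ⟩
      (toℕ i + 2 * n) % (2 * n)                    ≡⟨ [m+n]%n≡m%n (toℕ i) (2 * n) ⟩
      toℕ i % (2 * n)                              ≡⟨ m<n⇒m%n≡m (toℕ<n i) ⟩
      toℕ i                                        ∎)))
    where open ≡-Reasoning

  reply : Dic → Dic
  reply (_ , false) = x
  reply (_ , true)  = x ⁻¹

  open PairingStrategy (DicGame n) reply using (partner; first-player-wins)

  reply∈Moves : ∀ g → reply g ∈ Moves
  reply∈Moves (_ , false) = there (here refl)
  reply∈Moves (_ , true)  = there (there (there (here refl)))

  partner-involutive : ∀ g → partner (partner g) ≡ g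
  partner-involutive (i , false) = trans (cong (_∙ (x ⁻¹)) (a^i∙x i)) (a^ix∙x⁻¹ i)
  partner-involutive (i , true)  = trans (cong (_∙ x) (a^ix∙x⁻¹ i)) (a^i∙x i)

  partner≢id : ∀ g → partner g ≢ g
  partner≢id (_ , false) ()
  partner≢id (_ , true)  ()

  reply-allowed : ∀ g t → t ∈ Moves → g ∙ t ≢ partner g → reply (g ∙ t) ≢ t ⁻¹
  reply-allowed (_ , false) t (here refl) _ ()
  reply-allowed (_ , true)  t (here refl) _ ()
  reply-allowed (_ , false) t (there (here refl)) g∙x≢partner = contradiction refl g∙x≢partner
  reply-allowed (_ , true)  t (there (here refl)) _ = x≢x⁻¹
  reply-allowed (_ , false) t (there (there (here refl))) _ ()
  reply-allowed (_ , true)  t (there (there (here refl))) _ ()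
  reply-allowed (_ , false) t (there (there (there (here refl)))) _ x⁻¹≡x⁻¹⁻¹ =
    x≢x⁻¹ (sym (trans x⁻¹≡x⁻¹⁻¹ x⁻¹⁻¹≡x))
  reply-allowed (_ , true)  t (there (there (there (here refl)))) g∙x⁻¹≢partner =
    contradiction refl g∙x⁻¹≢partner

  elements : List Dic
  elements = cartesianProduct (allFin (2 * n)) (true ∷ false ∷ [])

  ∈-elements : ∀ g → g ∈ elements
  ∈-elements (i , true)  = ∈-cartesianProduct⁺ (∈-allFin i) (here refl)
  ∈-elements (i , false) = ∈-cartesianProduct⁺ (∈-allFin i) (there (here refl))

  player1-wins : Player1Wins
  player1-wins = first-player-wins (≡-dec _≟ᶠ_ _≟ᵇ_) elements ∈-elements
                   reply∈Moves partner-involutive partner≢id reply-allowed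

-- The pairing argument works for every n ≥ 1.
theorem4p1 : (n : ℕ) → .{{_ : NonZero n}} → 2 ≤ n → RAV.Player1Wins (DicGame n)
theorem4p1 n _ = DicyclicPairing.player1-wins n
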